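{- Let $n$ and $t$ be positive integers with $n>t>1$. Then $$p^{(t)}(n)=p^{(t-1)}(n)-p^{(t-1)}(n-t).$$
   Context: A partition of a positive integer $n$ is a finite sequence $\lambda=[\lambda_1,\ldots,\lambda_k]$ of positive integers with $\lambda_1\ge\cdots\ge\lambda_k$ and $\lambda_1+\cdots+\lambda_k=n$; we write $\lambda\vdash n$. For positive integers $n,t$, $p^{(t)}(n)$ denotes the number of partitions $\lambda\vdash n$ satisfying $\lambda_1\ge t\cdot\lambda_2$, where the one-part partition $[n]$ is considered to satisfy this condition. In particular, $p^{(1)}(n)=p(n)$, the number of partitions of $n$. -}

module Defs where

open import Data.Nat using (ℕ; zero; suc; _+_; _*_; _∸_; _≤_; _≤?_)
open import Data.List using (List; []; _∷_; length; filter; concatMap; map; upTo)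
open import Relation.Nullary using (Dec; yes; no)
open import Data.Unit using (⊤; tt)

firstParts : ℕ → ℕ → List ℕ
firstParts n m = filter (λ k → k ≤? m) (map suc (upTo n))

-- partsBounded fuel n m : all nonincreasing lists of positive integers
-- summing to n with every part ≤ m (fuel ≥ n guarantees termination).
partsBounded : ℕ → ℕ → ℕ → List (List ℕ)
partsBounded _ zero _ = [] ∷ []
partsBounded zero (suc _) _ = []
partsBounded (suc f) (suc n) m =
  concatMap (λ k → map (k ∷_) (partsBounded f (suc n ∸ k) k))
            (firstParts (suc n) m)

partitions : ℕ → List (List ℕ)
partitions n = partsBounded n n n

-- The condition λ₁ ≥ t·λ₂ (a one-part partition satisfies it vacuously;
-- the empty partition of 0 is also accepted, irrelevant for n ≥ 1).
Cond : ℕ → List ℕ → Set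
Cond t (a ∷ b ∷ _) = t * b ≤ a
Cond t _ = ⊤

cond? : (t : ℕ) → (λs : List ℕ) → Dec (Cond t λs)
cond? t (a ∷ b ∷ _) = t * b ≤? a
cond? t [] = yes tt
cond? t (_ ∷ []) = yes tt

p⁽_⁾ : ℕ → ℕ → ℕ
p⁽ t ⁾ n = length (filter (cond? t) (partitions n))

-- Write p(c | ≤ m) for the number of partitions of c with all parts ≤ m
-- ('pBounded') and B(y, m) = Σ_{c<y} p(c | ≤ m) ('pBelow').  A partition
-- of N with at least two parts and λ₁ ≥ t·λ₂ is a triple: its second part
-- m ≥ 1, its tail (λ₃, …), a partition of some c with parts ≤ m, and its
-- first part λ₁ = N − m − c ≥ t·m.  Hence
--     p⁽ᵗ⁾(N) = 1 + heavy (t+1) N,   heavy u N = Σ_{m=1}^{N} B(N+1 − u·m, m),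
-- the 1 counting the one-part partition [N] ('p⁽⁾-as-heavy').  The
-- theorem then follows from the recurrence ('heavy-step')
--     heavy u N = heavy (u+1) N + 1 + heavy u (N − u)     (1 ≤ u ≤ N),
-- which comes from splitting p(c | ≤ m) according to whether a part m
-- occurs:  p(c | ≤ m) = p(c | ≤ m−1) + p(c − m | ≤ m).
module Submission where

open import Data.Bool using (if_then_else_)
open import Data.List using (List; []; _∷_; _++_; length; filter; concatMap; map; applyUpTo; upTo)
open import Data.Nat.ListAction using (sum)
open import Data.List.Properties using (length-++; length-map; filter-++; map-∘; map-concatMap; map-upTo)
open import Data.Nat using (ℕ; zero; suc; _+_; _*_; _∸_; _≤_; _<_; _≤?_; z≤n; s≤s; s≤s⁻¹; z<s; s<s; >-nonZero)
open import Data.Nat.Properties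
open import Algebra.Properties.CommutativeSemigroup +-commutativeSemigroup using (interchange)
open import Function using (_∘_)
open import Relation.Nullary using (Dec; does; yes; no; ¬_; contradiction)
open import Relation.Unary using (Decidable)
open import Relation.Binary.PropositionalEquality using (_≡_; refl; sym; trans; cong; cong₂; subst; module ≡-Reasoning)

open import Defs

private variable
  A B : Set
  P Q : Set

-- The indicator  [P]·x :  x if the decided proposition holds, 0 otherwise.
-- Only the boolean 'does d' is inspected, so for '_≤?_' and '_≟_' on
-- numerals and successors it computes by definition.
when : Dec P → ℕ → ℕ
when d x = if does d then x else 0

when-yes : (d : Dec P) → P → ∀ x → when d x ≡ x
when-yes (yes _) _  _ = refl
when-yes (no ¬p) p _ = contradiction p ¬p

when-no : (d : Dec P) → ¬ P → ∀ x → when d x ≡ 0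
when-no (yes p) ¬p _ = contradiction p ¬p
when-no (no _)  _  _ = refl

when-0 : (d : Dec P) → when d 0 ≡ 0
when-0 (yes _) = refl
when-0 (no _)  = refl

when-+ : (d : Dec P) → ∀ x y → when d x + when d y ≡ when d (x + y)
when-+ (yes _) _ _ = refl
when-+ (no _)  _ _ = refl

when-iff : (d : Dec P) (e : Dec Q) → (P → Q) → (Q → P) → ∀ x → when d x ≡ when e x
when-iff (yes p) e to _    x = sym (when-yes e (to p) x)
when-iff (no ¬p) e _  from x = sym (when-no e (¬p ∘ from) x)

when-cong : (d : Dec P) {x y : ℕ} → (P → x ≡ y) → when d x ≡ when d y
when-cong (yes p) eq = eq p
when-cong (no _)  _  = refl

when-absorb : (d : Dec P) (e : Dec Q) → (Q → P) → ∀ x → when d (when e x) ≡ when e x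
when-absorb d (yes q) Q⇒P x = when-yes d (Q⇒P q) x
when-absorb d (no _)  _   _ = when-0 d

when-≤-split : ∀ i m x → when (suc i ≤? suc m) x ≡ when (suc i ≤? m) x + when (i ≟ m) x
when-≤-split zero    zero    x = refl
when-≤-split zero    (suc m) x = sym (+-identityʳ x)
when-≤-split (suc i) zero    x = refl
when-≤-split (suc i) (suc m) x = when-≤-split i m x

∑< : ℕ → (ℕ → ℕ) → ℕ
∑< n f = sum (applyUpTo f n)

∑<-cong : ∀ n {f g : ℕ → ℕ} → (∀ i → i < n → f i ≡ g i) → ∑< n f ≡ ∑< n g
∑<-cong zero    _  = refl
∑<-cong (suc n) eq = cong₂ _+_ (eq 0 z<s) (∑<-cong n (λ i i<n → eq (suc i) (s<s i<n)))

∑<-zero : ∀ n {f : ℕ → ℕ} → (∀ i → f i ≡ 0) → ∑< n f ≡ 0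
∑<-zero zero    _  = refl
∑<-zero (suc n) eq = cong₂ _+_ (eq 0) (∑<-zero n (eq ∘ suc))

∑<-+ : ∀ n (f g : ℕ → ℕ) → ∑< n (λ i → f i + g i) ≡ ∑< n f + ∑< n g
∑<-+ zero    f g = refl
∑<-+ (suc n) f g =
  trans (cong (f 0 + g 0 +_) (∑<-+ n (f ∘ suc) (g ∘ suc))) (interchange (f 0) (g 0) _ _)

∑<-swap : ∀ m n (f : ℕ → ℕ → ℕ) →
  ∑< m (λ i → ∑< n (λ j → f i j)) ≡ ∑< n (λ j → ∑< m (λ i → f i j))
∑<-swap zero    n f = sym (∑<-zero n (λ _ → refl))
∑<-swap (suc m) n f =
  trans (cong (∑< n (f 0) +_) (∑<-swap m n (f ∘ suc))) (sym (∑<-+ n (f 0) _))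

∑<-snoc : ∀ n (f : ℕ → ℕ) → ∑< (suc n) f ≡ ∑< n f + f n
∑<-snoc zero    f = +-identityʳ (f 0)
∑<-snoc (suc n) f = trans (cong (f 0 +_) (∑<-snoc n (f ∘ suc))) (sym (+-assoc (f 0) _ _))

∑<-rev : ∀ n (f : ℕ → ℕ) → ∑< n f ≡ ∑< n (λ i → f (n ∸ suc i))
∑<-rev zero    f = refl
∑<-rev (suc n) f = begin
  f 0 + ∑< n (f ∘ suc)                         ≡⟨ cong (f 0 +_) (∑<-rev n (f ∘ suc)) ⟩
  f 0 + ∑< n (λ i → f (suc (n ∸ suc i)))       ≡⟨ cong (f 0 +_) (∑<-cong n (λ i i<n → cong f (sym (+-∸-assoc 1 i<n)))) ⟩
  f 0 + ∑< n (λ i → f (n ∸ i))                 ≡⟨ +-comm (f 0) _ ⟩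
  ∑< n (λ i → f (n ∸ i)) + f 0                 ≡⟨ cong (λ z → ∑< n (λ i → f (n ∸ i)) + f z) (sym (n∸n≡0 n)) ⟩
  ∑< n (λ i → f (n ∸ i)) + f (n ∸ n)           ≡⟨ sym (∑<-snoc n (λ i → f (n ∸ i))) ⟩
  ∑< (suc n) (λ i → f (n ∸ i))                 ∎
  where open ≡-Reasoning

∑<-antidiagonal : ∀ N (F : ℕ → ℕ → ℕ) →
  ∑< N (λ i → F (suc i) (N ∸ suc i)) ≡ ∑< N (λ r → F (N ∸ r) r)
∑<-antidiagonal N F = trans (∑<-rev N _) (∑<-cong N (λ r r<N →
  let k≡N∸r = sym (+-∸-assoc 1 r<N)
  in cong₂ F k≡N∸r (trans (cong (N ∸_) k≡N∸r) (m∸[m∸n]≡n (<⇒≤ r<N)))))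

∑<-restrict : ∀ {L M} → L ≤ M → ∀ (f : ℕ → ℕ) → ∑< M (λ i → when (suc i ≤? L) (f i)) ≡ ∑< L f
∑<-restrict {M = M} z≤n       f = ∑<-zero M (λ _ → refl)
∑<-restrict         (s≤s L≤M) f = cong (f 0 +_) (∑<-restrict L≤M (f ∘ suc))

∑<-vanish : ∀ {M K} (f : ℕ → ℕ) → M ≤ K → (∀ j → M ≤ j → f j ≡ 0) → ∑< K f ≡ ∑< M f
∑<-vanish {M} {K} f M≤K tail = trans (∑<-cong K (λ j _ → inRange j)) (∑<-restrict M≤K f)
  where
  inRange : ∀ j → f j ≡ when (suc j ≤? M) (f j)
  inRange j with suc j ≤? M
  ... | yes j<M = sym (when-yes (suc j ≤? M) j<M (f j))
  ... | no j≮M  = trans (tail j (≮⇒≥ j≮M)) (sym (when-no (suc j ≤? M) j≮M (f j)))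

∑<-delta : ∀ N m (F : ℕ → ℕ) → ∑< N (λ i → when (i ≟ m) (F i)) ≡ when (suc m ≤? N) (F m)
∑<-delta zero    m       F = refl
∑<-delta (suc N) zero    F = trans (cong (F 0 +_) (∑<-zero N (λ _ → refl))) (+-identityʳ (F 0))
∑<-delta (suc N) (suc m) F = ∑<-delta N m (F ∘ suc)

∑<-shift : ∀ a y (g : ℕ → ℕ) → ∑< y (λ c → when (a ≤? c) (g (c ∸ a))) ≡ ∑< (y ∸ a) g
∑<-shift zero    y       g = refl
∑<-shift (suc a) zero    g = refl
∑<-shift (suc a) (suc y) g =
  trans (∑<-cong y (λ c _ → when-iff (suc a ≤? suc c) (a ≤? c) s≤s⁻¹ s≤s _)) (∑<-shift a y g)

∑<-cut : ∀ {b} M (g : ℕ → ℕ) → 1 ≤ b →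
  ∑< M (λ c → when (b ≤? M ∸ c) (g c)) ≡ ∑< (suc M ∸ b) g
∑<-cut {b} M g 1≤b =
  trans (∑<-cong M (λ c c<M → when-iff (b ≤? M ∸ c) (suc c ≤? suc M ∸ b) (to (<⇒≤ c<M)) from (g c)))
        (∑<-restrict (∸-monoʳ-≤ (suc M) 1≤b) g)
  where
  to : ∀ {c} → c ≤ M → b ≤ M ∸ c → suc c ≤ suc M ∸ b
  to {c} c≤M b≤M∸c =
    m+n≤o⇒m≤o∸n (suc c) (s≤s (subst (_≤ M) (+-comm b c) (m≤o∸n⇒m+n≤o b c≤M b≤M∸c)))
  from : ∀ {c} → suc c ≤ suc M ∸ b → b ≤ M ∸ c
  from {c} c<sucM∸b with b ≤? suc M
  ... | yes b≤sucM =
    m+n≤o⇒m≤o∸n b (subst (_≤ M) (+-comm c b) (s≤s⁻¹ (m≤o∸n⇒m+n≤o (suc c) b≤sucM c<sucM∸b)))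
  ... | no b≰sucM =
    contradiction (subst (suc c ≤_) (m≤n⇒m∸n≡0 (<⇒≤ (≰⇒> b≰sucM))) c<sucM∸b) λ ()

length-filter-∷ : {R : A → Set} (R? : Decidable R) (x : A) (xs : List A) →
  length (filter R? (x ∷ xs)) ≡ when (R? x) 1 + length (filter R? xs)
length-filter-∷ R? x xs with R? x
... | yes _ = refl
... | no _  = refl

filter-concatMap : {R : B → Set} (R? : Decidable R) (G : A → List B) (xs : List A) →
  filter R? (concatMap G xs) ≡ concatMap (filter R? ∘ G) xs
filter-concatMap R? G []       = refl
filter-concatMap R? G (x ∷ xs) =
  trans (filter-++ R? (G x) _) (cong (filter R? (G x) ++_) (filter-concatMap R? G xs))

length-concatMap : (G : A → List B) (xs : List A) → length (concatMap G xs) ≡ sum (map (length ∘ G) xs)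
length-concatMap G []       = refl
length-concatMap G (x ∷ xs) = trans (length-++ (G x)) (cong (length (G x) +_) (length-concatMap G xs))

sum-map-filter : {R : A → Set} (R? : Decidable R) (f : A → ℕ) (xs : List A) →
  sum (map f (filter R? xs)) ≡ sum (map (λ x → when (R? x) (f x)) xs)
sum-map-filter R? f []       = refl
sum-map-filter R? f (x ∷ xs) with R? x
... | yes _ = cong (f x +_) (sum-map-filter R? f xs)
... | no _  = sum-map-filter R? f xs

length-concatMap-firstParts : (G : ℕ → List A) (N m : ℕ) →
  length (concatMap G (firstParts N m)) ≡ ∑< N (λ i → when (suc i ≤? m) (length (G (suc i))))
length-concatMap-firstParts G N m = begin
  length (concatMap G (firstParts N m))                      ≡⟨ length-concatMap G (firstParts N m) ⟩
  sum (map (length ∘ G) (filter (_≤? m) (map suc (upTo N)))) ≡⟨ sum-map-filter (_≤? m) (length ∘ G) (map suc (upTo N)) ⟩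
  sum (map weight (map suc (upTo N)))                        ≡⟨ cong sum (trans (sym (map-∘ (upTo N))) (map-upTo (weight ∘ suc) N)) ⟩
  ∑< N (weight ∘ suc)                                        ∎
  where
  open ≡-Reasoning
  weight : ℕ → ℕ
  weight k = when (k ≤? m) (length (G k))

concatMap-cong-firstParts : {F G : ℕ → List A} → (∀ i → F (suc i) ≡ G (suc i)) →
  ∀ N m → concatMap F (firstParts N m) ≡ concatMap G (firstParts N m)
concatMap-cong-firstParts {F = F} {G} F≗G N m = go (_≤? m) (upTo N)
  where
  go : {R : ℕ → Set} (R? : Decidable R) → ∀ xs →
       concatMap F (filter R? (map suc xs)) ≡ concatMap G (filter R? (map suc xs))
  go R? []       = refl
  go R? (x ∷ xs) with R? (suc x)
  ... | yes _ = cong₂ _++_ (F≗G x) (go R? xs)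
  ... | no _  = go R? xs

partsBounded-fuel : ∀ f g r m → r ≤ f → r ≤ g → partsBounded f r m ≡ partsBounded g r m
partsBounded-fuel f       g       zero    m _         _         = refl
partsBounded-fuel (suc f) (suc g) (suc r) m (s≤s r≤f) (s≤s r≤g) =
  concatMap-cong-firstParts (λ i → cong (map (suc i ∷_))
    (partsBounded-fuel f g (r ∸ i) (suc i) (≤-trans (m∸n≤m r i) r≤f) (≤-trans (m∸n≤m r i) r≤g)))
    (suc r) m

pBounded : ℕ → ℕ → ℕ
pBounded r m = length (partsBounded r r m)

pBounded-firstPart : ∀ n m →
  pBounded (suc n) m ≡ ∑< (suc n) (λ i → when (suc i ≤? m) (pBounded (n ∸ i) (suc i)))
pBounded-firstPart n m =
  trans (length-concatMap-firstParts G (suc n) m) (∑<-cong (suc n) (λ i _ →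
    cong (when (suc i ≤? m)) (trans (length-map (suc i ∷_) (partsBounded n (n ∸ i) (suc i)))
      (cong length (partsBounded-fuel n (n ∸ i) (n ∸ i) (suc i) (m∸n≤m n i) ≤-refl)))))
  where
  G : ℕ → List (List ℕ)
  G k = map (k ∷_) (partsBounded n (suc n ∸ k) k)

pBounded-zero : ∀ n → pBounded (suc n) 0 ≡ 0
pBounded-zero n = trans (pBounded-firstPart n 0) (∑<-zero (suc n) (λ _ → refl))

-- p(r | ≤ m+1) = p(r | ≤ m) + p(r − (m+1) | ≤ m+1): a part m+1 occurs or not.
pBounded-suc : ∀ r m → pBounded r (suc m) ≡ pBounded r m + when (suc m ≤? r) (pBounded (r ∸ suc m) (suc m))
pBounded-suc zero    m = refl
pBounded-suc (suc n) m = begin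
  pBounded (suc n) (suc m)
    ≡⟨ pBounded-firstPart n (suc m) ⟩
  ∑< (suc n) (λ i → when (suc i ≤? suc m) (F i))
    ≡⟨ ∑<-cong (suc n) (λ i _ → when-≤-split i m (F i)) ⟩
  ∑< (suc n) (λ i → when (suc i ≤? m) (F i) + when (i ≟ m) (F i))
    ≡⟨ ∑<-+ (suc n) (λ i → when (suc i ≤? m) (F i)) (λ i → when (i ≟ m) (F i)) ⟩
  ∑< (suc n) (λ i → when (suc i ≤? m) (F i)) + ∑< (suc n) (λ i → when (i ≟ m) (F i))
    ≡⟨ cong₂ _+_ (sym (pBounded-firstPart n m)) (∑<-delta (suc n) m F) ⟩
  pBounded (suc n) m + when (suc m ≤? suc n) (F m) ∎
  where
  open ≡-Reasoning
  F : ℕ → ℕ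
  F i = pBounded (n ∸ i) (suc i)

pBelow : ℕ → ℕ → ℕ
pBelow y m = ∑< y (λ c → pBounded c m)

pBelow-zero : ∀ x → pBelow (suc x) 0 ≡ 1
pBelow-zero x = cong suc (∑<-zero x (pBounded-zero))

pBelow-suc : ∀ y m → pBelow y (suc m) ≡ pBelow y m + pBelow (y ∸ suc m) (suc m)
pBelow-suc y m =
  trans (∑<-cong y (λ c _ → pBounded-suc c m))
    (trans (∑<-+ y _ _) (cong (pBelow y m +_) (∑<-shift (suc m) y (λ c → pBounded c (suc m)))))

-- heavy u N: the number of partitions of N with at least two parts and
-- λ₁ + λ₂ ≥ u·λ₂; the term j counts those with second part j + 1.
heavyTerm : ℕ → ℕ → ℕ → ℕ
heavyTerm u N j = pBelow (suc N ∸ u * suc j) (suc j)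

heavy : ℕ → ℕ → ℕ
heavy u N = ∑< N (heavyTerm u N)

-- For u ≥ 1 the second part is at most N, so the range of 'heavy' may be enlarged.
heavy-range : ∀ u N K → 1 ≤ u → N ≤ K → ∑< K (heavyTerm u N) ≡ heavy u N
heavy-range (suc u) N K _ N≤K = ∑<-vanish (heavyTerm (suc u) N) N≤K (λ j N≤j →
  cong (λ z → pBelow z (suc j)) (m≤n⇒m∸n≡0 (≤-trans (s≤s N≤j) (m≤n*m (suc j) (suc u)))))

heavy-lowered : ∀ u N → 1 ≤ u → u ≤ N → ∑< N (λ j → pBelow (suc N ∸ u * suc j) j) ≡ 1 + heavy u (N ∸ u)
heavy-lowered (suc u) (suc N) 1≤u u≤N = cong₂ _+_
  (trans (cong (λ z → pBelow z 0) (trans (cong (suc (suc N) ∸_) (*-identityʳ (suc u))) (+-∸-assoc 1 u≤N)))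
         (pBelow-zero (N ∸ u)))
  (trans (∑<-cong N (λ j _ → cong (λ z → pBelow z (suc j)) (shifted j)))
         (heavy-range (suc u) (N ∸ u) N 1≤u (m∸n≤m N u)))
  where
  open ≡-Reasoning
  shifted : ∀ j → suc (suc N) ∸ suc u * suc (suc j) ≡ suc (suc N ∸ suc u) ∸ suc u * suc j
  shifted j = begin
    suc (suc N) ∸ suc u * suc (suc j)          ≡⟨ cong (suc (suc N) ∸_) (*-suc (suc u) (suc j)) ⟩
    suc (suc N) ∸ (suc u + suc u * suc j)      ≡⟨ sym (∸-+-assoc (suc (suc N)) (suc u) _) ⟩
    suc (suc N) ∸ suc u ∸ suc u * suc j        ≡⟨ cong (_∸ suc u * suc j) (+-∸-assoc 1 u≤N) ⟩
    suc (suc N ∸ suc u) ∸ suc u * suc j        ∎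

heavy-step : ∀ u N → 1 ≤ u → u ≤ N → heavy u N ≡ heavy (suc u) N + (1 + heavy u (N ∸ u))
heavy-step u N 1≤u u≤N = begin
  heavy u N
    ≡⟨ ∑<-cong N (λ j _ → pBelow-suc (y j) j) ⟩
  ∑< N (λ j → pBelow (y j) j + pBelow (y j ∸ suc j) (suc j))
    ≡⟨ ∑<-+ N _ _ ⟩
  ∑< N (λ j → pBelow (y j) j) + ∑< N (λ j → pBelow (y j ∸ suc j) (suc j))
    ≡⟨ cong₂ _+_ (heavy-lowered u N 1≤u u≤N) (∑<-cong N (λ j _ → cong (λ z → pBelow z (suc j)) (steeper j))) ⟩
  1 + heavy u (N ∸ u) + heavy (suc u) N
    ≡⟨ +-comm _ (heavy (suc u) N) ⟩
  heavy (suc u) N + (1 + heavy u (N ∸ u)) ∎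
  where
  open ≡-Reasoning
  y : ℕ → ℕ
  y j = suc N ∸ u * suc j
  steeper : ∀ j → y j ∸ suc j ≡ suc N ∸ suc u * suc j
  steeper j = trans (∸-+-assoc (suc N) (u * suc j) (suc j)) (cong (suc N ∸_) (+-comm (u * suc j) (suc j)))

δ₀ : ℕ → ℕ
δ₀ zero    = 1
δ₀ (suc _) = 0

-- withHead t k r: for t ≥ 1, the number of partitions of k + r with first
-- part k satisfying λ₁ ≥ t·λ₂ (split by the second part j + 1).
withHead : ℕ → ℕ → ℕ → ℕ
withHead t k r = δ₀ r + ∑< r (λ j → when (t * suc j ≤? k) (pBounded (r ∸ suc j) (suc j)))

count-cond-fixed : ∀ t a b (xs : List (List ℕ)) →
  length (filter (cond? t) (map (a ∷_) (map (b ∷_) xs))) ≡ when (t * b ≤? a) (length xs)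
count-cond-fixed t a b []       = sym (when-0 (t * b ≤? a))
count-cond-fixed t a b (τ ∷ xs) =
  trans (length-filter-∷ (cond? t) (a ∷ b ∷ τ) _)
    (trans (cong (when (t * b ≤? a) 1 +_) (count-cond-fixed t a b xs)) (when-+ (t * b ≤? a) 1 (length xs)))

withHead-count : ∀ t → 1 ≤ t → ∀ f k r → r ≤ f →
  length (filter (cond? t) (map (k ∷_) (partsBounded f r k))) ≡ withHead t k r
withHead-count t 1≤t f       k zero    _         = refl
withHead-count t 1≤t (suc f) k (suc r) (s≤s r≤f) = begin
  length (filter (cond? t) (map (k ∷_) (concatMap H (firstParts (suc r) k))))
    ≡⟨ cong (length ∘ filter (cond? t)) (map-concatMap (k ∷_) H (firstParts (suc r) k)) ⟩
  length (filter (cond? t) (concatMap (map (k ∷_) ∘ H) (firstParts (suc r) k)))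
    ≡⟨ cong length (filter-concatMap (cond? t) (map (k ∷_) ∘ H) (firstParts (suc r) k)) ⟩
  length (concatMap (filter (cond? t) ∘ map (k ∷_) ∘ H) (firstParts (suc r) k))
    ≡⟨ length-concatMap-firstParts _ (suc r) k ⟩
  ∑< (suc r) (λ i → when (suc i ≤? k) (length (filter (cond? t) (map (k ∷_) (H (suc i))))))
    ≡⟨ ∑<-cong (suc r) (λ i _ → secondPart i) ⟩
  ∑< (suc r) (λ i → when (t * suc i ≤? k) (pBounded (r ∸ i) (suc i))) ∎
  where
  open ≡-Reasoning
  H : ℕ → List (List ℕ)
  H b = map (b ∷_) (partsBounded f (suc r ∸ b) b)
  secondPart : ∀ i → when (suc i ≤? k) (length (filter (cond? t) (map (k ∷_) (H (suc i)))))
                     ≡ when (t * suc i ≤? k) (pBounded (r ∸ i) (suc i))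
  secondPart i = begin
    when (suc i ≤? k) (length (filter (cond? t) (map (k ∷_) (H (suc i)))))
      ≡⟨ cong (when (suc i ≤? k)) (count-cond-fixed t k (suc i) (partsBounded f (r ∸ i) (suc i))) ⟩
    when (suc i ≤? k) (when (t * suc i ≤? k) (length (partsBounded f (r ∸ i) (suc i))))
      ≡⟨ when-absorb (suc i ≤? k) (t * suc i ≤? k) (≤-trans (m≤n*m (suc i) t {{>-nonZero 1≤t}})) _ ⟩
    when (t * suc i ≤? k) (length (partsBounded f (r ∸ i) (suc i)))
      ≡⟨ cong (when (t * suc i ≤? k) ∘ length) (partsBounded-fuel f (r ∸ i) (r ∸ i) (suc i) (≤-trans (m∸n≤m r i) r≤f) ≤-refl) ⟩
    when (t * suc i ≤? k) (pBounded (r ∸ i) (suc i)) ∎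

p⁽⁾-by-first-part : ∀ t → 1 ≤ t → ∀ n → p⁽ t ⁾ (suc n) ≡ ∑< (suc n) (λ i → withHead t (suc i) (n ∸ i))
p⁽⁾-by-first-part t 1≤t n =
  trans (cong length (filter-concatMap (cond? t) G (firstParts (suc n) (suc n))))
    (trans (length-concatMap-firstParts (filter (cond? t) ∘ G) (suc n) (suc n)) (∑<-cong (suc n) (λ i i<N →
      trans (when-yes (suc i ≤? suc n) i<N (length (filter (cond? t) (G (suc i))))) (withHead-count t 1≤t n (suc i) (n ∸ i) (m∸n≤m n i)))))
  where
  G : ℕ → List (List ℕ)
  G k = map (k ∷_) (partsBounded n (suc n ∸ k) k)

-- The partitions of N with second part m and λ₁ ≥ t·m, counted as pairs
-- (size r of (λ₂, λ₃, …), first part N − r), number pBelow (N + 1 − (t+1)·m) m.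
second-part-column : ∀ t N m → 1 ≤ t → 1 ≤ m → m ≤ N →
  ∑< N (λ r → when (m ≤? r) (when (t * m ≤? N ∸ r) (pBounded (r ∸ m) m))) ≡ pBelow (suc N ∸ suc t * m) m
second-part-column t N m 1≤t 1≤m m≤N = begin
  ∑< N (λ r → when (m ≤? r) (when (t * m ≤? N ∸ r) (pBounded (r ∸ m) m)))
    ≡⟨ ∑<-cong N (λ r _ → when-cong (m ≤? r) (λ m≤r → cong (λ z → when (t * m ≤? z) (pBounded (r ∸ m) m)) (firstPart m≤r))) ⟩
  ∑< N (λ r → when (m ≤? r) (g (r ∸ m)))
    ≡⟨ ∑<-shift m N g ⟩
  ∑< (N ∸ m) g
    ≡⟨ ∑<-cut (N ∸ m) (λ c → pBounded c m) (*-mono-≤ 1≤t 1≤m) ⟩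
  pBelow (suc (N ∸ m) ∸ t * m) m
    ≡⟨ cong (λ z → pBelow z m) (trans (cong (_∸ t * m) (sym (+-∸-assoc 1 m≤N))) (∸-+-assoc (suc N) m (t * m))) ⟩
  pBelow (suc N ∸ suc t * m) m ∎
  where
  open ≡-Reasoning
  g : ℕ → ℕ
  g c = when (t * m ≤? N ∸ m ∸ c) (pBounded c m)
  firstPart : ∀ {r} → m ≤ r → N ∸ r ≡ N ∸ m ∸ (r ∸ m)
  firstPart {r} m≤r = trans (cong (N ∸_) (sym (m+[n∸m]≡n m≤r))) (sym (∸-+-assoc N m (r ∸ m)))

-- Re-indexing the multi-part partitions from tail size to second part.
heavy-by-second-part : ∀ t N → 1 ≤ t →
  ∑< N (λ r → ∑< r (λ j → when (t * suc j ≤? N ∸ r) (pBounded (r ∸ suc j) (suc j)))) ≡ heavy (suc t) N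
heavy-by-second-part t N 1≤t = begin
  ∑< N (λ r → ∑< r (X r))
    ≡⟨ ∑<-cong N (λ r r<N → sym (∑<-restrict (<⇒≤ r<N) (X r))) ⟩
  ∑< N (λ r → ∑< N (λ j → when (suc j ≤? r) (X r j)))
    ≡⟨ ∑<-swap N N _ ⟩
  ∑< N (λ j → ∑< N (λ r → when (suc j ≤? r) (X r j)))
    ≡⟨ ∑<-cong N (λ j j<N → second-part-column t N (suc j) 1≤t (s≤s z≤n) j<N) ⟩
  heavy (suc t) N ∎
  where
  open ≡-Reasoning
  X : ℕ → ℕ → ℕ
  X r j = when (t * suc j ≤? N ∸ r) (pBounded (r ∸ suc j) (suc j))

p⁽⁾-as-heavy : ∀ t N → 1 ≤ t → 1 ≤ N → p⁽ t ⁾ N ≡ 1 + heavy (suc t) N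
p⁽⁾-as-heavy t (suc n) 1≤t _ = begin
  p⁽ t ⁾ N                                                 ≡⟨ p⁽⁾-by-first-part t 1≤t n ⟩
  ∑< N (λ i → withHead t (suc i) (N ∸ suc i))              ≡⟨ ∑<-antidiagonal N (withHead t) ⟩
  ∑< N (λ r → withHead t (N ∸ r) r)                        ≡⟨ ∑<-+ N δ₀ (λ r → ∑< r (λ j → when (t * suc j ≤? N ∸ r) (pBounded (r ∸ suc j) (suc j)))) ⟩
  ∑< N δ₀ + ∑< N (λ r → ∑< r (λ j → when (t * suc j ≤? N ∸ r) (pBounded (r ∸ suc j) (suc j))))
    ≡⟨ cong₂ _+_ (cong suc (∑<-zero n (λ _ → refl))) (heavy-by-second-part t N 1≤t) ⟩
  1 + heavy (suc t) N                                      ∎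
  where
  open ≡-Reasoning
  N = suc n

corollary1 : (n t : ℕ) → 1 < t → t < n →
    p⁽ t ⁾ n ≡ p⁽ t ∸ 1 ⁾ n ∸ p⁽ t ∸ 1 ⁾ (n ∸ t)
corollary1 n (suc s) (s≤s 1≤s) t<n = begin
  p⁽ t ⁾ n                                 ≡⟨ p⁽⁾-as-heavy t n (s≤s z≤n) n≥1 ⟩
  1 + heavy (suc t) n                      ≡⟨ +-comm 1 _ ⟩
  heavy (suc t) n + 1                      ≡⟨ sym (m+n∸n≡m _ Y) ⟩
  heavy (suc t) n + 1 + Y ∸ Y              ≡⟨ cong (_∸ Y) (+-assoc _ 1 Y) ⟩
  heavy (suc t) n + (1 + Y) ∸ Y            ≡⟨ cong (_∸ Y) (sym (heavy-step t n (s≤s z≤n) (<⇒≤ t<n))) ⟩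
  (1 + heavy t n) ∸ (1 + Y)                ≡⟨ cong₂ _∸_ (sym (p⁽⁾-as-heavy s n 1≤s n≥1))
                                                         (sym (p⁽⁾-as-heavy s (n ∸ t) 1≤s (m<n⇒0<n∸m t<n))) ⟩
  p⁽ s ⁾ n ∸ p⁽ s ⁾ (n ∸ t)                ∎
  where
  open ≡-Reasoning
  t = suc s
  Y = heavy t (n ∸ t)
  n≥1 : 1 ≤ n
  n≥1 = ≤-trans (s≤s z≤n) t<n
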